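{- Let $\mathcal{F}$ be a finite union-closed family of sets with $\emptyset\notin\mathcal{F}$, $\bigcup_{A\in\mathcal{F}}A=\{1,\dots,n\}$, and height number $H(\mathcal{F})=2$, with height decomposition $\mathcal{F}=\pi_1\cup\pi_2$. Then: (i) for every element $x\in\{1,\dots,n\}$, the number of sets in $\pi_1$ (the 2nd height) not containing $x$ is at most $1$; (ii) the number of sets in $\pi_1$ satisfies $1\le|\pi_1|\le n$.
   Context: A union-closed family is a finite family $\mathcal{F}$ of finite sets closed under pairwise union. Height decomposition: $\pi_1$ is the set of inclusion-minimal members of $\mathcal{F}$; inductively, while $\mathcal{F}\setminus(\pi_1\cup\dots\cup\pi_{i-1})\neq\emptyset$, $\pi_i$ is the set of inclusion-minimal members of $\mathcal{F}\setminus(\pi_1\cup\dots\cup\pi_{i-1})$; the number of steps until $\mathcal{F}$ is exhausted is the height number $H(\mathcal{F})$. The $j$-th height is $\pi_{H(\mathcal{F})+1-j}$; thus when $H(\mathcal{F})=2$, the 1st height is $\pi_2=\{\{1,\dots,n\}\}$ and the 2nd height is $\pi_1$. -}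

module Defs where

open import Data.Nat using (ℕ; zero; suc)
open import Data.Bool using (Bool)
open import Data.Bool.Properties using () renaming (_≟_ to _≟ᵇ_)
open import Data.Fin using (Fin)
open import Data.Fin.Subset using (Subset; _⊆_; _∪_; ⊥; ⊤; _∈_)
open import Data.Fin.Subset.Properties using (_⊆?_)
open import Data.Vec.Properties using (≡-dec)
open import Data.List using (List; []; _∷_; filter; length; foldr)
open import Data.List.Membership.Propositional using () renaming (_∈_ to _∈ₗ_)
open import Data.List.Membership.DecPropositional using () renaming (_∈?_ to ∈?-gen)
open import Data.List.Relation.Unary.All using (all?)
open import Relation.Binary.Definitions using (DecidableEquality)
open import Relation.Binary.PropositionalEquality using (_≡_)
open import Relation.Nullary.Decidable using (Dec; ¬?; _→-dec_)

_≟ˢ_ : ∀ {n} → DecidableEquality (Subset n)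
_≟ˢ_ = ≡-dec _≟ᵇ_

-- A family of subsets of Fin n, as a duplicate-free list (see Statement).
Family : ℕ → Set
Family n = List (Subset n)

UnionClosed : ∀ {n} → Family n → Set
UnionClosed F = ∀ {A B} → A ∈ₗ F → B ∈ₗ F → (A ∪ B) ∈ₗ F

⋃ : ∀ {n} → Family n → Subset n
⋃ F = foldr _∪_ ⊥ F

isMinimalIn? : ∀ {n} (G : Family n) (A : Subset n) → Dec (Data.List.Relation.Unary.All.All (λ B → B ⊆ A → B ≡ A) G)
isMinimalIn? G A = all? (λ B → (B ⊆? A) →-dec (B ≟ˢ A)) G

minimals : ∀ {n} → Family n → Family n
minimals G = filter (isMinimalIn? G) G

rest : ∀ {n} → Family n → Family n
rest G = filter (λ A → ¬? (∈?-gen _≟ˢ_ A (minimals G))) G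

-- π_i : minimal members of F ∖ (π_1 ∪ … ∪ π_{i-1}), i ≥ 1
π : ∀ {n} → ℕ → Family n → Family n
π zero    F = []
π (suc zero) F = minimals F
π (suc (suc i)) F = π (suc i) (rest F)

heightFuel : ∀ {n} → ℕ → Family n → ℕ
heightFuel zero    G = zero
heightFuel (suc k) [] = zero
heightFuel (suc k) (A ∷ G) = suc (heightFuel k (rest (A ∷ G)))

-- Height number H(F); fuel length F suffices since each step removes ≥ 1 set
H : ∀ {n} → Family n → ℕ
H F = heightFuel (length F) F

-- Peeling off the minimal members of F leaves rest F, and H F ≡ 2 says that every member
-- of rest F is minimal in rest F. Being union-closed, F contains ⊤ = ⋃ F, which lies above
-- every member and so is not minimal in F; hence ⊤ is minimal in rest F, which forces
-- F = π₁ ∪ {⊤}. If two members C, D of F both miss x, then C ∪ D ≠ ⊤ is minimal in F and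
-- contains both, so C = C ∪ D = D. This is (i); it also makes any choice of an element
-- missed by each member of π₁ injective, whence |π₁| ≤ n.
module Submission where

open import Defs
open import Data.Nat using (ℕ; suc; _≤_; _<_; s≤s)
open import Data.Nat.Properties using (suc-injective; ≤-pred; ≤-trans)
open import Data.Fin using (Fin; zero; suc)
open import Data.Fin.Properties using (injective⇒≤; ¬∀⟶∃¬)
open import Data.Fin.Subset using (Subset; ⊥; ⊤; _⊆_; _∪_; _∈_; _∉_)
open import Data.Fin.Subset.Properties
  using (_∈?_; _⊆?_; ⊆-antisym; ⊆-trans; ⊆⊤; ∈⊤; p⊆p∪q; q⊆p∪q; x∈p∪q⁻; ∪-identityʳ)
open import Data.List using (List; []; _∷_; length; filter; lookup)
open import Data.List.Membership.Propositional using () renaming (_∈_ to _∈ₗ_)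
open import Data.List.Membership.DecPropositional using () renaming (_∈?_ to ∈?-gen)
open import Data.List.Membership.Propositional.Properties
  using (∈-filter⁺; ∈-filter⁻; ∈-lookup; ∈-length)
open import Data.List.Relation.Unary.All using (All; []; _∷_; tabulate) renaming (lookup to lookupᴬ)
import Data.List.Relation.Unary.Any as Any
open import Data.List.Relation.Unary.Any using (here; there)
open import Data.List.Relation.Unary.AllPairs using (_∷_)
open import Data.List.Relation.Unary.Unique.Propositional using (Unique)
open import Data.List.Relation.Unary.Unique.Propositional.Properties using (filter⁺)
open import Data.List.Properties using (filter-notAll)
open import Data.Product using (_×_; _,_; proj₁; proj₂; ∃)
open import Data.Sum using (_⊎_; inj₁; inj₂; [_,_]; map₂)
open import Function using (id)
open import Function.Definitions using (Injective)
open import Relation.Binary.PropositionalEquality using (_≡_; refl; sym; trans; cong; subst)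
open import Relation.Nullary using (¬_; Dec; yes; no; contradiction)
open import Relation.Nullary.Decidable using (¬?)

private
  variable
    n m : ℕ
    X : Set
    xs : List X
    A B C D M : Subset n
    F G L : Family n

Unique⇒lookup-injective : Unique xs → Injective _≡_ _≡_ (lookup xs)
Unique⇒lookup-injective {xs = _ ∷ _} _          {zero}  {zero}  _  = refl
Unique⇒lookup-injective {xs = _ ∷ _} (x∉xs ∷ _) {zero}  {suc j} eq =
  contradiction eq (lookupᴬ x∉xs (∈-lookup j))
Unique⇒lookup-injective {xs = _ ∷ _} (x∉xs ∷ _) {suc i} {zero}  eq =
  contradiction (sym eq) (lookupᴬ x∉xs (∈-lookup i))
Unique⇒lookup-injective {xs = _ ∷ _} (_ ∷ u)    {suc i} {suc j} eq =
  cong suc (Unique⇒lookup-injective u eq)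

unique⇒length≤ : Unique xs → (f : ∀ {x} → x ∈ₗ xs → Fin m)
  → (∀ {x y} (p : x ∈ₗ xs) (q : y ∈ₗ xs) → f p ≡ f q → x ≡ y) → length xs ≤ m
unique⇒length≤ u f f-injective = injective⇒≤ λ {i} {j} fi≡fj →
  Unique⇒lookup-injective u (f-injective (∈-lookup i) (∈-lookup j) fi≡fj)

all-equal⇒length≤1 : Unique xs → (∀ {x y} → x ∈ₗ xs → y ∈ₗ xs → x ≡ y) → length xs ≤ 1
all-equal⇒length≤1 u all-equal = unique⇒length≤ u (λ _ → zero) λ p q _ → all-equal p q

Minimal : Family n → Subset n → Set
Minimal G M = All (λ B → B ⊆ M → B ≡ M) G

minimal-exists : A ∈ₗ G → ∃ λ M → M ∈ₗ G × Minimal G M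
minimal-exists {G = C ∷ []}    _ = C , here refl , (λ _ → refl) ∷ []
minimal-exists {G = C ∷ D ∷ G} _ with minimal-exists {G = D ∷ G} (here refl)
... | M , M∈ , M-minimal with C ⊆? M
...   | no C⊈M  = M , there M∈ , (λ C⊆M → contradiction (λ {x} → C⊆M {x}) C⊈M) ∷ M-minimal
...   | yes C⊆M = C , here refl , (λ _ → refl) ∷ tabulate below-C
  where
  -- B ⊆ C ⊆ M forces B = M by minimality of M, hence C ⊆ B.
  below-C : B ∈ₗ D ∷ G → B ⊆ C → B ≡ C
  below-C B∈ B⊆C = ⊆-antisym B⊆C (subst (C ⊆_) (sym (lookupᴬ M-minimal B∈ (⊆-trans B⊆C C⊆M))) C⊆M)

∈-minimals⁺ : M ∈ₗ G → Minimal G M → M ∈ₗ minimals G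
∈-minimals⁺ {G = G} = ∈-filter⁺ (isMinimalIn? G)

∈-minimals⁻ : (G : Family n) → M ∈ₗ minimals G → M ∈ₗ G × Minimal G M
∈-minimals⁻ G = ∈-filter⁻ (isMinimalIn? G)

∈-rest⁺ : A ∈ₗ G → ¬ A ∈ₗ minimals G → A ∈ₗ rest G
∈-rest⁺ {G = G} = ∈-filter⁺ (λ X → ¬? (∈?-gen _≟ˢ_ X (minimals G)))

∈-rest⁻ : (G : Family n) → A ∈ₗ rest G → A ∈ₗ G × ¬ A ∈ₗ minimals G
∈-rest⁻ G = ∈-filter⁻ (λ X → ¬? (∈?-gen _≟ˢ_ X (minimals G))) {xs = G}

∈-minimals⊎∈-rest : A ∈ₗ G → A ∈ₗ minimals G ⊎ A ∈ₗ rest G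
∈-minimals⊎∈-rest {A = A} {G = G} A∈ with ∈?-gen _≟ˢ_ A (minimals G)
... | yes A∈minimals = inj₁ A∈minimals
... | no  A∉minimals = inj₂ (∈-rest⁺ A∈ A∉minimals)

rest≡[]⇒Minimal : rest G ≡ [] → A ∈ₗ G → Minimal G A
rest≡[]⇒Minimal rest≡[] A∈ with ∈-minimals⊎∈-rest A∈
... | inj₁ A∈minimals = proj₂ (∈-minimals⁻ _ A∈minimals)
... | inj₂ A∈rest with () ← subst (_ ∈ₗ_) rest≡[] A∈rest

length-rest< : A ∈ₗ G → length (rest G) < length G
length-rest< {G = G} A∈ with minimal-exists A∈
... | M , M∈ , M-minimal = filter-notAll (λ X → ¬? (∈?-gen _≟ˢ_ X (minimals G))) G
  (Any.map (λ { refl M∉minimals → M∉minimals (∈-minimals⁺ M∈ M-minimal) }) M∈)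

heightFuel≡0⇒[] : ∀ k (G : Family n) → heightFuel k G ≡ 0 → length G ≤ k → G ≡ []
heightFuel≡0⇒[] k       []      _  _  = refl
heightFuel≡0⇒[] (suc k) (_ ∷ _) () _

heightFuel≡1⇒ : ∀ k (G : Family n) → heightFuel k G ≡ 1 → length G ≤ k
  → (∃ λ A → A ∈ₗ G) × rest G ≡ []
heightFuel≡1⇒ (suc k) (A ∷ G) eq (s≤s |G|≤k) = (A , here refl) ,
  heightFuel≡0⇒[] k (rest (A ∷ G)) (suc-injective eq)
    (≤-trans (≤-pred (length-rest< {A = A} (here refl))) |G|≤k)

H≡2⇒ : (F : Family n) → H F ≡ 2 → (∃ λ B → B ∈ₗ rest F) × rest (rest F) ≡ []
H≡2⇒ (A ∷ G) eq =
  heightFuel≡1⇒ (length G) (rest (A ∷ G)) (suc-injective eq) (≤-pred (length-rest< {A = A} (here refl)))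

⋃-∈ : UnionClosed F → All (_∈ₗ F) (A ∷ L) → ⋃ (A ∷ L) ∈ₗ F
⋃-∈ {F = F} {L = []}    _  (A∈ ∷ []) = subst (_∈ₗ F) (sym (∪-identityʳ _)) A∈
⋃-∈         {L = _ ∷ _} uc (A∈ ∷ L∈) = uc A∈ (⋃-∈ uc L∈)

⋃-∈-self : UnionClosed F → A ∈ₗ F → ⋃ F ∈ₗ F
⋃-∈-self {F = _ ∷ _} uc _ = ⋃-∈ uc (tabulate id)

module HeightTwo {F : Family n} (uc : UnionClosed F) (⋃F≡⊤ : ⋃ F ≡ ⊤)
                 {B : Subset n} (B∈rest : B ∈ₗ rest F) (rest²≡[] : rest (rest F) ≡ []) where

  B∈F : B ∈ₗ F
  B∈F = proj₁ (∈-rest⁻ F B∈rest)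

  ⊤∈F : ⊤ ∈ₗ F
  ⊤∈F = subst (_∈ₗ F) ⋃F≡⊤ (⋃-∈-self uc B∈F)

  ⊤∉minimals : ¬ ⊤ ∈ₗ minimals F
  ⊤∉minimals ⊤∈minimals = proj₂ (∈-rest⁻ F B∈rest) (subst (_∈ₗ minimals F) (sym B≡⊤) ⊤∈minimals)
    where
    B≡⊤ : B ≡ ⊤
    B≡⊤ = lookupᴬ (proj₂ (∈-minimals⁻ F ⊤∈minimals)) B∈F ⊆⊤

  ∈-minimals⊎≡⊤ : A ∈ₗ F → A ∈ₗ minimals F ⊎ A ≡ ⊤
  ∈-minimals⊎≡⊤ A∈ = map₂ (λ A∈rest → lookupᴬ ⊤-minimal A∈rest ⊆⊤) (∈-minimals⊎∈-rest A∈)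
    where
    ⊤-minimal : Minimal (rest F) ⊤
    ⊤-minimal = rest≡[]⇒Minimal rest²≡[] (∈-rest⁺ ⊤∈F ⊤∉minimals)

  missing-same-element⇒≡ : ∀ {x} → x ∉ C → x ∉ D → C ∈ₗ F → D ∈ₗ F → C ≡ D
  missing-same-element⇒≡ {C = C} {D = D} {x} x∉C x∉D C∈ D∈ with ∈-minimals⊎≡⊤ (uc C∈ D∈)
  ... | inj₁ C∪D∈minimals = trans (lookupᴬ C∪D-minimal C∈ (p⊆p∪q D))
                                  (sym (lookupᴬ C∪D-minimal D∈ (q⊆p∪q C D)))
    where
    C∪D-minimal : Minimal F (C ∪ D)
    C∪D-minimal = proj₂ (∈-minimals⁻ F C∪D∈minimals)
  ... | inj₂ C∪D≡⊤ = contradiction (x∈p∪q⁻ C D (subst (x ∈_) (sym C∪D≡⊤) ∈⊤)) [ x∉C , x∉D ]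

  minimal-misses : M ∈ₗ minimals F → ∃ λ x → x ∉ M
  minimal-misses {M = M} M∈ = ¬∀⟶∃¬ n (_∈ M) (_∈? M) λ ∀x∈M →
    ⊤∉minimals (subst (_∈ₗ minimals F) (⊆-antisym ⊆⊤ (λ {x} _ → ∀x∈M x)) M∈)

  length-missing≤1 : Unique F → ∀ x → length (filter (λ A → ¬? (x ∈? A)) (minimals F)) ≤ 1
  length-missing≤1 uF x = all-equal⇒length≤1 (filter⁺ missing? (filter⁺ (isMinimalIn? F) uF))
    λ C∈ D∈ → let C∈minimals , x∉C = ∈-filter⁻ missing? C∈
                  D∈minimals , x∉D = ∈-filter⁻ missing? D∈
              in missing-same-element⇒≡ x∉C x∉D (proj₁ (∈-minimals⁻ F C∈minimals))
                                                (proj₁ (∈-minimals⁻ F D∈minimals))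
    where
    missing? : (A : Subset n) → Dec (x ∉ A)
    missing? A = ¬? (x ∈? A)

  1≤length-minimals : 1 ≤ length (minimals F)
  1≤length-minimals with minimal-exists B∈F
  ... | M , M∈ , M-minimal = ∈-length (∈-minimals⁺ M∈ M-minimal)

  length-minimals≤ : Unique F → length (minimals F) ≤ n
  length-minimals≤ uF = unique⇒length≤ (filter⁺ (isMinimalIn? F) uF) (λ M∈ → proj₁ (minimal-misses M∈))
    λ M∈ M′∈ same → missing-same-element⇒≡
      (subst (_∉ _) same (proj₂ (minimal-misses M∈))) (proj₂ (minimal-misses M′∈))
      (proj₁ (∈-minimals⁻ F M∈)) (proj₁ (∈-minimals⁻ F M′∈))

lemma3p1p1 : (n : ℕ) (F : Family n) → Unique F → UnionClosed F
    → ¬ (⊥ ∈ₗ F) → ⋃ F ≡ ⊤ → H F ≡ 2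
    → ((x : Fin n) → length (filter (λ A → ¬? (x ∈? A)) (π 1 F)) ≤ 1)
    × (1 ≤ length (π 1 F) × length (π 1 F) ≤ n)
lemma3p1p1 n F uF uc _ ⋃F≡⊤ H≡2 with H≡2⇒ F H≡2
... | (B , B∈rest) , rest²≡[] = length-missing≤1 uF , 1≤length-minimals , length-minimals≤ uF
  where open HeightTwo uc ⋃F≡⊤ B∈rest rest²≡[]
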